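{- Let $\langle M,M_0,M_1,S\rangle$ be a Memory-factoring Abstract Generating Automaton (MAGA) for $\mathcal{L}$, as defined in the context. Then $|S|\ge 24$.
   Context: Let $\Sigma=\{A,B,C,a,b,c,\alpha,\beta,\gamma\}$ be nine observables arranged in a $3\times3$ array with rows $(A,B,C)$, $(a,b,c)$, $(\alpha,\beta,\gamma)$. The six contexts are the three rows and the three columns, viewed as 3-element sets. Two observables are compatible if they lie in a common context (every observable is compatible with itself), and incompatible otherwise. Each context has a required product: $+1$ for every context except $\{C,c,\gamma\}$, whose required product is $-1$. Let $\tilde\Sigma=\{A,\tilde A,\dots,\gamma,\tilde\gamma\}$ (18 letters). The letter $x$ means "observable $x$ measured with value $1$", and $\tilde x$ means "observable $x$ measured with value $-1$". Determination: for the empty word all observables are undetermined. Processing the next measurement (observable $x$, value $v$) proceeds as follows: (i) every observable incompatible with $x$ becomes undetermined, while compatible ones keep their status and value; (ii) $x$ becomes determined with value $v$; (iii) as long as some context has exactly two determined observables, its third observable becomes determined with the value making the product of the three values equal to the context's required product. A word $\sigma$ determines an observable $s$ with value $v$ if, after processing $\sigma$, $s$ is determined with value $v$. A word $x_1\cdots x_n$ (with values $v_i$) is consistent if for each $i$, whenever $x_i$ is determined after processing the first $i-1$ measurements, its value at that point equals $v_i$. $\mathcal{L}\subseteq\tilde\Sigma^*$ is the set of consistent words. A MAGA for $\mathcal{L}$ is a quadruple $\langle M,M_0,M_1,S\rangle$ satisfying the following: - $S$ is a finite or countably infinite set (of "memory states"); - $M_0:\mathcal{L}\times\Sigma\to S\times\Sigma$,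 $M_1:S\times\Sigma\to\{1,-1,r\}$ and $M=M_1\circ M_0$ are computable functions; - $M_0$ leaves the $\Sigma$-coordinate unchanged and its state depends only on the word, i.e. $M_0(\sigma,s)=(m(\sigma),s)$ for some function $m:\mathcal{L}\to S$; - for all $\sigma\in\mathcal{L}$ and $s\in\Sigma$: $M(\sigma,s)=1$ if $\sigma$ determines $s$ with value $1$; $M(\sigma,s)=-1$ if $\sigma$ determines $s$ with value $-1$; and $M(\sigma,s)=r$ if $\sigma$ does not determine $s$. -}

module Defs where

open import Data.Nat using (ℕ; zero; suc; _≡ᵇ_)
open import Data.Bool using (Bool; true; false; _∧_; _∨_; if_then_else_)
open import Data.Maybe using (Maybe; just; nothing)
open import Data.List using (List; []; _∷_; foldl)
open import Data.Product using (Σ; _×_; _,_; proj₁)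
open import Data.Sum using (_⊎_)
open import Data.Unit using (⊤)
open import Relation.Binary.PropositionalEquality using (_≡_)
open import Function.Definitions using (Injective)

data Obs : Set where
  A B C a b c α β γ : Obs

code : Obs → ℕ
code A = 0
code B = 1
code C = 2
code a = 3
code b = 4
code c = 5
code α = 6
code β = 7
code γ = 8

_==_ : Obs → Obs → Bool
x == y = code x ≡ᵇ code y

-- Measurement values: pos = +1, neg = -1
data Sign : Set where
  pos neg : Sign

infixl 7 _·_
_·_ : Sign → Sign → Sign
pos · s = s
neg · pos = neg
neg · neg = pos

data Ctx : Set where
  row1 row2 row3 col1 col2 col3 : Ctx

allCtx : List Ctx
allCtx = row1 ∷ row2 ∷ row3 ∷ col1 ∷ col2 ∷ col3 ∷ []

members : Ctx → Obs × Obs × Obs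
members row1 = A , B , C
members row2 = a , b , c
members row3 = α , β , γ
members col1 = A , a , α
members col2 = B , b , β
members col3 = C , c , γ

req : Ctx → Sign
req col3 = neg
req _    = pos

inCtx : Obs → Ctx → Bool
inCtx x k with members k
... | p , q , t = (x == p) ∨ (x == q) ∨ (x == t)

anyCtx : (Ctx → Bool) → List Ctx → Bool
anyCtx f []       = false
anyCtx f (k ∷ ks) = f k ∨ anyCtx f ks

compatible : Obs → Obs → Bool
compatible x y = anyCtx (λ k → inCtx x k ∧ inCtx y k) allCtx

-- A letter of Σ̃: (x , pos) is x, (x , neg) is x̃
Letter : Set
Letter = Obs × Sign

Word : Set
Word = List Letter

-- determination status: nothing = undetermined, just v = determined with value v
State : Set
State = Obs → Maybe Sign

empty : State
empty _ = nothing

set : State → Obs → Sign → State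
set st o v y = if y == o then just v else st y

measure : State → Obs → Sign → State
measure st x v y =
  if y == x then just v else (if compatible x y then st y else nothing)

tryCtx : State → Ctx → Maybe (Obs × Sign)
tryCtx st k with members k
... | p , q , t with st p | st q | st t
...   | just u  | just v  | nothing = just (t , u · v · req k)
...   | just u  | nothing | just w  = just (q , u · w · req k)
...   | nothing | just v  | just w  = just (p , v · w · req k)
...   | _       | _       | _       = nothing

findCtx : State → List Ctx → Maybe (Obs × Sign)
findCtx st []       = nothing
findCtx st (k ∷ ks) with tryCtx st k
... | just res = just res
... | nothing = findCtx st ks

-- step (iii), iterated; each iteration determines a new observable, so
-- 9 iterations always suffice to reach the point where no context has
-- exactly two determined observables.
saturate : ℕ → State → State
saturate zero    st = st
saturate (suc n) st with findCtx st allCtx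
... | nothing      = st
... | just (o , v) = saturate n (set st o v)

step : State → Letter → State
step st (x , v) = saturate 9 (measure st x v)

run : Word → State
run = foldl step empty

consistentFrom : State → Word → Set
consistentFrom st []             = ⊤
consistentFrom st ((x , v) ∷ w) =
  (st x ≡ nothing ⊎ st x ≡ just v) × consistentFrom (step st (x , v)) w

Consistent : Word → Set
Consistent = consistentFrom empty

𝓛 : Set
𝓛 = Σ Word Consistent

data Out : Set where
  plus minus r : Out

det : Word → Obs → Out
det σ s with run σ s
... | nothing    = r
... | just pos   = plus
... | just neg   = minus

record MAGA : Set₁ where
  field
    S        : Set
    -- S finite or countably infinite: injects into ℕ
    countable : Σ (S → ℕ) (Injective _≡_ _≡_)
    M₀       : 𝓛 × Obs → S × Obs
    M₁       : S × Obs → Out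
    m        : 𝓛 → S
    M₀-form  : ∀ σ s → M₀ (σ , s) ≡ (m σ , s)
    correct  : ∀ σ s → M₁ (M₀ (σ , s)) ≡ det (proj₁ σ) s

-- For each of the six contexts and each pair of signs, measuring two observables
-- of the context with those values determines exactly that context (the third
-- value being forced by the required product) and nothing else. These 24 words
-- have pairwise different determination profiles, and the profile of σ can be
-- read off the memory state alone as s ↦ M₁ (m σ , s); so their memory states
-- are pairwise different.

module Submission where

open import Defs
open import Data.Fin using (Fin; zero; suc; #_; remQuot; combine)
open import Data.Fin.Properties using (combine-remQuot)
open import Data.List using (_∷_; []; lookup)
open import Data.Product using (Σ; _×_; _,_; proj₁; proj₂; map)
open import Data.Sum using (inj₁)
open import Data.Unit using (tt)
open import Function using (_∘_)
open import Function.Definitions using (Injective)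
open import Relation.Binary.PropositionalEquality
  using (_≡_; _≗_; refl; sym; trans; cong; cong₂; module ≡-Reasoning)

retraction⇒injective : ∀ {A B : Set} {f : A → B} (g : B → A) →
                       (∀ x → g (f x) ≡ x) → Injective _≡_ _≡_ f
retraction⇒injective {f = f} g g∘f≗id {x} {y} fx≡fy =
  trans (sym (g∘f≗id x)) (trans (cong g fx≡fy) (g∘f≗id y))

Profile : Set
Profile = Obs → Out

module _ (G : MAGA) where
  open MAGA G

  readout : S → Profile
  readout z s = M₁ (z , s)

  det≗readout : ∀ σ → det (proj₁ σ) ≗ readout (m σ)
  det≗readout σ s = trans (sym (correct σ s)) (cong M₁ (M₀-form σ s))

  memory-injective : ∀ {I : Set} (word : I → 𝓛) (decode : Profile → I) →
                     (∀ {f g} → f ≗ g → decode f ≡ decode g) →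
                     (∀ i → decode (det (proj₁ (word i))) ≡ i) →
                     Injective _≡_ _≡_ (m ∘ word)
  memory-injective word decode decode-cong decode-word =
    retraction⇒injective (decode ∘ readout) λ i → begin
      decode (readout (m (word i)))   ≡⟨ decode-cong (λ s → sym (det≗readout (word i) s)) ⟩
      decode (det (proj₁ (word i)))   ≡⟨ decode-word i ⟩
      i                               ∎
    where open ≡-Reasoning

first second : Ctx → Obs
first  k = proj₁ (members k)
second k = proj₁ (proj₂ (members k))

Probe : Set
Probe = Ctx × Sign × Sign

probeWord : Probe → Word
probeWord (k , u , v) = (first k , u) ∷ (second k , v) ∷ []

probeWord-consistent : ∀ x → Consistent (probeWord x)
probeWord-consistent (row1 , u , v) = inj₁ refl , inj₁ refl , tt
probeWord-consistent (row2 , u , v) = inj₁ refl , inj₁ refl , tt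
probeWord-consistent (row3 , u , v) = inj₁ refl , inj₁ refl , tt
probeWord-consistent (col1 , u , v) = inj₁ refl , inj₁ refl , tt
probeWord-consistent (col2 , u , v) = inj₁ refl , inj₁ refl , tt
probeWord-consistent (col3 , u , v) = inj₁ refl , inj₁ refl , tt

probe : Probe → 𝓛
probe x = probeWord x , probeWord-consistent x

-- determinedContext and toSign are meaningful only on profiles whose determined
-- observables form a single context, such as those of probe words.
determinedContext : Profile → Ctx
determinedContext f with f A | f B | f C | f a
... | r | r | r | r = row3
... | r | r | r | _ = row2
... | r | r | _ | _ = col3
... | r | _ | _ | _ = col2
... | _ | r | _ | _ = col1
... | _ | _ | _ | _ = row1

toSign : Out → Sign
toSign minus = neg
toSign _     = pos

decode : Profile → Probe
decode f = k , toSign (f (first k)) , toSign (f (second k))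
  where
  k : Ctx
  k = determinedContext f

determinedContext-cong : ∀ {f g} → f ≗ g → determinedContext f ≡ determinedContext g
determinedContext-cong {f} {g} f≗g rewrite f≗g A | f≗g B | f≗g C | f≗g a = refl

decode-cong : ∀ {f g} → f ≗ g → decode f ≡ decode g
decode-cong {f} {g} f≗g
  rewrite determinedContext-cong f≗g
        | f≗g (first (determinedContext g))
        | f≗g (second (determinedContext g)) = refl

decode-probe : ∀ x → decode (det (probeWord x)) ≡ x
decode-probe (row1 , pos , pos) = refl
decode-probe (row1 , pos , neg) = refl
decode-probe (row1 , neg , pos) = refl
decode-probe (row1 , neg , neg) = refl
decode-probe (row2 , pos , pos) = refl
decode-probe (row2 , pos , neg) = refl
decode-probe (row2 , neg , pos) = refl
decode-probe (row2 , neg , neg) = refl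
decode-probe (row3 , pos , pos) = refl
decode-probe (row3 , pos , neg) = refl
decode-probe (row3 , neg , pos) = refl
decode-probe (row3 , neg , neg) = refl
decode-probe (col1 , pos , pos) = refl
decode-probe (col1 , pos , neg) = refl
decode-probe (col1 , neg , pos) = refl
decode-probe (col1 , neg , neg) = refl
decode-probe (col2 , pos , pos) = refl
decode-probe (col2 , pos , neg) = refl
decode-probe (col2 , neg , pos) = refl
decode-probe (col2 , neg , neg) = refl
decode-probe (col3 , pos , pos) = refl
decode-probe (col3 , pos , neg) = refl
decode-probe (col3 , neg , pos) = refl
decode-probe (col3 , neg , neg) = refl

ctxIndex : Ctx → Fin 6
ctxIndex row1 = # 0
ctxIndex row2 = # 1
ctxIndex row3 = # 2
ctxIndex col1 = # 3
ctxIndex col2 = # 4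
ctxIndex col3 = # 5

ctxIndex-lookup : ∀ i → ctxIndex (lookup allCtx i) ≡ i
ctxIndex-lookup zero                               = refl
ctxIndex-lookup (suc zero)                         = refl
ctxIndex-lookup (suc (suc zero))                   = refl
ctxIndex-lookup (suc (suc (suc zero)))             = refl
ctxIndex-lookup (suc (suc (suc (suc zero))))       = refl
ctxIndex-lookup (suc (suc (suc (suc (suc zero))))) = refl

signAt : Fin 2 → Sign
signAt zero       = pos
signAt (suc zero) = neg

signIndex : Sign → Fin 2
signIndex pos = # 0
signIndex neg = # 1

signIndex-signAt : ∀ i → signIndex (signAt i) ≡ i
signIndex-signAt zero       = refl
signIndex-signAt (suc zero) = refl

probeAt : Fin 24 → Probe
probeAt i = map (lookup allCtx) (map signAt signAt ∘ remQuot 2) (remQuot {6} 4 i)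

probeIndex : Probe → Fin 24
probeIndex (k , u , v) = combine (ctxIndex k) (combine (signIndex u) (signIndex v))

probeIndex-probeAt : ∀ i → probeIndex (probeAt i) ≡ i
probeIndex-probeAt i = begin
  combine (ctxIndex (lookup allCtx k)) (combine (signIndex (signAt u)) (signIndex (signAt v)))
    ≡⟨ cong₂ combine (ctxIndex-lookup k) (cong₂ combine (signIndex-signAt u) (signIndex-signAt v)) ⟩
  combine k (combine u v)  ≡⟨ cong (combine k) (combine-remQuot {2} 2 j) ⟩
  combine k j              ≡⟨ combine-remQuot {6} 4 i ⟩
  i                        ∎
  where
  open ≡-Reasoning
  k : Fin 6
  k = proj₁ (remQuot {6} 4 i)
  j : Fin 4
  j = proj₂ (remQuot {6} 4 i)
  u v : Fin 2
  u = proj₁ (remQuot {2} 2 j)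
  v = proj₂ (remQuot {2} 2 j)

theorem4 : (G : MAGA) → Σ (Fin 24 → MAGA.S G) (Injective _≡_ _≡_)
theorem4 G = MAGA.m G ∘ probe ∘ probeAt , inj
  where
  inj : Injective _≡_ _≡_ (MAGA.m G ∘ probe ∘ probeAt)
  inj = retraction⇒injective probeIndex probeIndex-probeAt
      ∘ memory-injective G probe decode decode-cong decode-probe
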